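{- Let $g\ge4$ be even and let $m$ be an odd number relatively prime to $g$. If $o_g(m)>2^{\lceil \log_g \frac{m}{g-1}\rceil}$, or in particular if $o_g(m)>2\big(\frac{m}{g-1}\big)^{1/\log_2 g}$, then $m$ is not primitive.
   Context: For an odd integer $m\ge1$, an extreme cycle for the digit set $\{0,m\}$ (with respect to $g$) is a finite set of distinct integers $\{x_0,\dots,x_{r-1}\}$ together with digits $l_0,\dots,l_{r-1}\in\{0,m\}$ such that $x_{j+1}=(x_j+l_j)/g$ for $0\le j\le r-2$ and $x_0=(x_{r-1}+l_{r-1})/g$. The cycle $\{0\}$ is the trivial extreme cycle. $m$ is complete if the only extreme cycle for $\{0,m\}$ is the trivial one, and incomplete otherwise. An odd number $m$ is primitive if it is incomplete and every proper divisor of $m$ is complete. $o_g(m)$ denotes the order of $g$ in $U(\mathbb{Z}_m)$; $\lceil x\rceil$ is the smallest integer $\ge x$. -}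

module Defs where

open import Data.Nat using (ℕ; zero; suc; _^_; _∸_; _≤_; _<_; _*_)
open import Data.Nat.DivMod using (_mod_)
open import Data.Nat.Divisibility using (_∣_)
open import Data.Fin using (Fin; toℕ)
open import Data.Integer as ℤ using (ℤ; +_)
open import Data.Product using (Σ; ∃; _×_)
open import Data.Sum using (_⊎_)
open import Relation.Binary.PropositionalEquality using (_≡_; _≢_)
open import Relation.Nullary using (¬_)
open import Function.Definitions using (Injective)

next : ∀ {n} → Fin (suc n) → Fin (suc n)
next {n} i = suc (toℕ i) mod suc n

-- An extreme cycle for the digit set {0,m} w.r.t. base g, of length r = suc n:
-- distinct integers x_0..x_{r-1}, digits l_j ∈ {0,m}, with
-- x_{j+1} = (x_j + l_j)/g (indices mod r), i.e. g * x_{j+1} = x_j + l_j.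
record ExtremeCycle (g m : ℕ) (n : ℕ) : Set where
  field
    x        : Fin (suc n) → ℤ
    l        : Fin (suc n) → ℤ
    distinct : Injective _≡_ _≡_ x
    digits   : ∀ j → (l j ≡ + 0) ⊎ (l j ≡ + m)
    step     : ∀ j → (+ g) ℤ.* x (next j) ≡ x j ℤ.+ l j

IsTrivial : ∀ {g m n} → ExtremeCycle g m n → Set
IsTrivial {n = n} c = (n ≡ 0) × (∀ j → ExtremeCycle.x c j ≡ + 0)

Incomplete : (g m : ℕ) → Set
Incomplete g m = Σ ℕ λ n → Σ (ExtremeCycle g m n) λ c → ¬ IsTrivial c

Complete : (g m : ℕ) → Set
Complete g m = ¬ Incomplete g m

Primitive : (g m : ℕ) → Set
Primitive g m = Incomplete g m × (∀ d → d ∣ m → d ≢ m → Complete g d)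

IsOrder : (g m o : ℕ) → Set
IsOrder g m o = (0 < o) × (m ∣ (g ^ o ∸ 1)) × (∀ k → 0 < k → m ∣ (g ^ k ∸ 1) → o ≤ k)

-- k = ⌈ log_g (m/(g-1)) ⌉ (for m ≥ 1, g ≥ 2 this is the least natural k
-- with m ≤ (g-1) * g^k)
IsCeilLog : (g m k : ℕ) → Set
IsCeilLog g m k = (m ≤ (g ∸ 1) * g ^ k) × (∀ j → m ≤ (g ∸ 1) * g ^ j → k ≤ j)

module Submission where

-- A nontrivial extreme cycle x₀, …, x_{r−1} for {0, m} consists of positive integers, and
-- (g − 1) x_t ≤ m ≤ (g − 1) g^k gives x_t ≤ g^k.  If two start points had the same k
-- consecutive digits, g^k x_{t+k} − x_t = g^k x_{s+k} − x_s would force x_t = x_s, so reading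
-- digit windows as binary numerals shows r ≤ 2^k.  If m were primitive, x₀ would be coprime
-- to m (a common factor d divides the whole cycle and yields a cycle for m / d), and then
-- g^r x₀ ≡ x₀ (mod m) gives o_g(m) ≤ r ≤ 2^k.

open import Defs
open import Data.Nat using (ℕ; zero; suc; _+_; _*_; _∸_; _^_; _≤_; _<_; z≤n; s≤s; z<s; NonZero; ≢-nonZero; ≢-nonZero⁻¹; >-nonZero)
open import Data.Nat.Properties
open import Data.Nat.DivMod
open import Data.Nat.Divisibility
open import Data.Nat.Coprimality using (Coprime; coprime-divisor)
open import Data.Fin as Fin using (Fin; toℕ; fromℕ<)
open import Data.Fin.Properties using (toℕ-fromℕ<; toℕ<n; toℕ-injective; pigeonhole)
open import Data.Product using (Σ; _×_; _,_; proj₁; proj₂)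
open import Data.Sum using (_⊎_; inj₁; inj₂)
open import Data.Empty using (⊥-elim)
open import Relation.Binary.PropositionalEquality
open import Relation.Nullary using (¬_)
open import Data.Integer as ℤ using (ℤ)
import Data.Integer.Properties as ℤP
open import Data.Nat.Tactic.RingSolver using (solve-∀)

bit+double-injective : ∀ {b c A B} → b ≤ 1 → c ≤ 1 → b + 2 * A ≡ c + 2 * B → b ≡ c × A ≡ B
bit+double-injective {A = A} {B} z≤n       z≤n       e = refl , *-cancelˡ-≡ A B 2 e
bit+double-injective {A = A} {B} (s≤s z≤n) (s≤s z≤n) e = refl , *-cancelˡ-≡ A B 2 (suc-injective e)
bit+double-injective {A = A} {B} z≤n       (s≤s z≤n) e = ⊥-elim (even≢odd A B e)
bit+double-injective {A = A} {B} (s≤s z≤n) z≤n       e = ⊥-elim (even≢odd B A (sym e))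

quotient-≤ : ∀ {G a c W A B} → 1 ≤ a → c ≤ G → G * A ≡ a + W → G * B ≡ c + W → B ≤ A
quotient-≤ {G} {a} {c} {W} {A} {B} 1≤a c≤G eA eB = m<1+n⇒m≤n (*-cancelˡ-< G B (suc A) (begin-strict
  G * B        ≡⟨ eB ⟩
  c + W        ≤⟨ +-monoˡ-≤ W c≤G ⟩
  G + W        <⟨ +-monoʳ-< G (m<n+m W 1≤a) ⟩
  G + (a + W)  ≡⟨ cong (G +_) eA ⟨
  G + G * A    ≡⟨ *-suc G A ⟨
  G * suc A    ∎))
  where open ≤-Reasoning

residue-unique : ∀ {G a c W A B} → 1 ≤ a → a ≤ G → 1 ≤ c → c ≤ G →
                 G * A ≡ a + W → G * B ≡ c + W → a ≡ c
residue-unique {G} {a} {c} {W} {A} {B} 1≤a a≤G 1≤c c≤G eA eB =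
  +-cancelʳ-≡ W a c (trans (sym eA) (trans (cong (G *_) A≡B) eB))
  where
  A≡B : A ≡ B
  A≡B = ≤-antisym (quotient-≤ 1≤c a≤G eB eA) (quotient-≤ 1≤a c≤G eA eB)

Ga≡a+mc∧c<G⇒a≤m : ∀ {G a m c} → 1 < G → c < G → G * a ≡ a + m * c → a ≤ m
Ga≡a+mc∧c<G⇒a≤m {suc H} {a} {m} {c} (s≤s 1≤H) c<G e = *-cancelˡ-≤ H {{>-nonZero 1≤H}} (begin
  H * a  ≡⟨ +-cancelˡ-≡ a (H * a) (m * c) e ⟩
  m * c  ≤⟨ *-monoʳ-≤ m (m<1+n⇒m≤n c<G) ⟩
  m * H  ≡⟨ *-comm m H ⟩
  H * m  ∎)
  where open ≤-Reasoning

even*y≡odd*bit⇒y≡0 : ∀ {g m y β} .{{_ : NonZero g}} → 2 ∣ g → ¬ 2 ∣ m → β ≤ 1 → g * y ≡ m * β → y ≡ 0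
even*y≡odd*bit⇒y≡0 {g} {m} {y} 2∣g m-odd z≤n e =
  *-cancelˡ-≡ y 0 g (trans e (trans (*-zeroʳ m) (sym (*-zeroʳ g))))
even*y≡odd*bit⇒y≡0 {g} {m} {y} 2∣g m-odd (s≤s z≤n) e =
  ⊥-elim (m-odd (subst (2 ∣_) (trans e (*-identityʳ m)) (∣-trans 2∣g (m∣m*n y))))

≤-multiple⇒nonneg : ∀ G z → 1 < G → z ℤ.≤ ℤ.+ G ℤ.* z → ℤ.+ 0 ℤ.≤ z
≤-multiple⇒nonneg G             (ℤ.+ _)    _        _            = ℤ.+≤+ z≤n
≤-multiple⇒nonneg (suc zero)    ℤ.-[1+ a ] (s≤s ()) _
≤-multiple⇒nonneg (suc (suc p)) ℤ.-[1+ a ] _        (ℤ.-≤- big≤a) = ⊥-elim (m+1+n≰m a big≤a)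

-- Iterating the growth condition once around the period gives X t ≤ g^(1+n) X t.
periodic-growth⇒nonneg : ∀ {g n} (X : ℕ → ℤ) → 1 < g → (∀ t → X t ℤ.≤ ℤ.+ g ℤ.* X (suc t)) →
                         (∀ t → X (t + suc n) ≡ X t) → ∀ t → ℤ.+ 0 ℤ.≤ X t
periodic-growth⇒nonneg {g} {n} X 1<g grows periodic t =
  ≤-multiple⇒nonneg (g ^ suc n) (X t) 1<g^[1+n]
    (subst (λ y → X t ℤ.≤ ℤ.+ (g ^ suc n) ℤ.* y) (periodic t) (growth (suc n) t))
  where
  1<g^[1+n] : 1 < g ^ suc n
  1<g^[1+n] = *-mono-≤ 1<g (m^n>0 g {{>-nonZero (<-trans z<s 1<g)}} n)
  growth : ∀ k s → X s ℤ.≤ ℤ.+ (g ^ k) ℤ.* X (s + k)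
  growth zero s = ℤP.≤-reflexive (sym (trans (ℤP.*-identityˡ (X (s + 0))) (cong X (+-identityʳ s))))
  growth (suc k) s = begin
    X s                            ≤⟨ growth k s ⟩
    gᵏ ℤ.* X (s + k)               ≤⟨ ℤP.*-monoˡ-≤-nonNeg gᵏ (grows (s + k)) ⟩
    gᵏ ℤ.* (ℤ.+ g ℤ.* X (1+s+k))   ≡⟨ ℤP.*-assoc gᵏ (ℤ.+ g) (X (1+s+k)) ⟨
    gᵏ ℤ.* ℤ.+ g ℤ.* X (1+s+k)     ≡⟨ cong₂ ℤ._*_ gᵏ⁺¹≡ (cong X (+-suc s k)) ⟨
    ℤ.+ (g * g ^ k) ℤ.* X (s + suc k) ∎
    where
    open ℤP.≤-Reasoning
    1+s+k : ℕ
    1+s+k = suc (s + k)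
    gᵏ : ℤ
    gᵏ = ℤ.+ (g ^ k)
    gᵏ⁺¹≡ : ℤ.+ (g * g ^ k) ≡ gᵏ ℤ.* ℤ.+ g
    gᵏ⁺¹≡ = trans (cong ℤ.+_ (*-comm g (g ^ k))) (ℤP.pos-* (g ^ k) g)

toℕ-mod : ∀ m n .{{_ : NonZero n}} → toℕ (m mod n) ≡ m % n
toℕ-mod m n = toℕ-fromℕ< (m%n<n m n)

mod-cong : ∀ m k n .{{_ : NonZero n}} → m % n ≡ k % n → m mod n ≡ k mod n
mod-cong m k n e = toℕ-injective (trans (toℕ-mod m n) (trans e (sym (toℕ-mod k n))))

[1+m%n]%n≡[1+m]%n : ∀ m n .{{_ : NonZero n}} → suc (m % n) % n ≡ suc m % n
[1+m%n]%n≡[1+m]%n m n = begin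
  (1 + m % n) % n          ≡⟨ %-distribˡ-+ 1 (m % n) n ⟩
  (1 % n + m % n % n) % n  ≡⟨ cong (λ u → (1 % n + u) % n) (m%n%n≡m%n m n) ⟩
  (1 % n + m % n) % n      ≡⟨ %-distribˡ-+ 1 m n ⟨
  (1 + m) % n              ∎
  where open ≡-Reasoning

next-mod : ∀ {n} t → next (t mod suc n) ≡ suc t mod suc n
next-mod {n} t = mod-cong (suc (toℕ (t mod suc n))) (suc t) (suc n)
  (trans (cong (λ u → suc u % suc n) (toℕ-mod t (suc n))) ([1+m%n]%n≡[1+m]%n t (suc n)))

next-fixed⇒n≡0 : ∀ {n} (i : Fin (suc n)) → next i ≡ i → n ≡ 0
next-fixed⇒n≡0 {n} i fixed with m≤n⇒m<n∨m≡n (toℕ<n i)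
... | inj₁ 1+i<1+n = ⊥-elim (1+n≢n (trans (sym (m<n⇒m%n≡m 1+i<1+n)) next-i≡i))
  where
  next-i≡i : suc (toℕ i) % suc n ≡ toℕ i
  next-i≡i = trans (sym (toℕ-mod (suc (toℕ i)) (suc n))) (cong toℕ fixed)
... | inj₂ 1+i≡1+n = trans (sym (suc-injective 1+i≡1+n)) (begin
  toℕ i                   ≡⟨ cong toℕ fixed ⟨
  toℕ (next i)            ≡⟨ toℕ-mod (suc (toℕ i)) (suc n) ⟩
  suc (toℕ i) % suc n     ≡⟨ cong (_% suc n) 1+i≡1+n ⟩
  suc n % suc n           ≡⟨ n%n≡0 (suc n) ⟩
  0                       ∎)
  where open ≡-Reasoning

toℕ%≡toℕ : ∀ {n} (i : Fin (suc n)) → toℕ i % suc n ≡ toℕ i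
toℕ%≡toℕ i = m<n⇒m%n≡m (toℕ<n i)

module Window (b : ℕ → ℕ) (b≤1 : ∀ t → b t ≤ 1) where

  window : ℕ → ℕ → ℕ → ℕ
  window B zero    t = 0
  window B (suc k) t = b t + B * window B k (suc t)

  window-bound : ∀ q k t → q * window (suc q) k t < suc q ^ k
  window-bound q zero    t = ≤-reflexive (cong suc (*-zeroʳ q))
  window-bound q (suc k) t = begin-strict
    q * (b t + B * w)        ≡⟨ *-distribˡ-+ q (b t) (B * w) ⟩
    q * b t + q * (B * w)    ≤⟨ +-monoˡ-≤ (q * (B * w)) (*-monoʳ-≤ q (b≤1 t)) ⟩
    q * 1 + q * (B * w)      ≡⟨ rearrange q B w ⟩
    q + B * (q * w)          <⟨ +-monoˡ-< (B * (q * w)) (n<1+n q) ⟩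
    B + B * (q * w)          ≡⟨ *-suc B (q * w) ⟨
    B * suc (q * w)          ≤⟨ *-monoʳ-≤ B (window-bound q k (suc t)) ⟩
    B * B ^ k                ∎
    where
    open ≤-Reasoning
    B w : ℕ
    B = suc q
    w = window B k (suc t)
    rearrange : ∀ q B w → q * 1 + q * (B * w) ≡ q + B * (q * w)
    rearrange = solve-∀

  binary-window< : ∀ k t → window 2 k t < 2 ^ k
  binary-window< k t = subst (_< 2 ^ k) (*-identityˡ (window 2 k t)) (window-bound 1 k t)

  window-determined : ∀ B k t s → window 2 k t ≡ window 2 k s → window B k t ≡ window B k s
  window-determined B zero    t s _ = refl
  window-determined B (suc k) t s e with bit+double-injective (b≤1 t) (b≤1 s) e
  ... | bt≡bs , rest≡ = cong₂ (λ u w → u + B * w) bt≡bs (window-determined B k (suc t) (suc s) rest≡)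

-- A nontrivial extreme cycle of length suc n, unrolled periodically to ℕ, with digit l_t = m * b t.
record Orbit (g m n : ℕ) : Set where
  field
    x         : ℕ → ℕ
    b         : ℕ → ℕ
    b≤1       : ∀ t → b t ≤ 1
    step      : ∀ t → g * x (suc t) ≡ x t + m * b t
    periodic  : ∀ t → x (t % suc n) ≡ x t
    injective : ∀ s t → x s ≡ x t → s % suc n ≡ t % suc n
    positive  : ∀ t → 1 ≤ x t

module _ {g m n : ℕ} (O : Orbit g m n) where
  open Orbit O
  open Window b b≤1

  x[t+1+n]≡x[t] : ∀ t → x (t + suc n) ≡ x t
  x[t+1+n]≡x[t] t = begin
    x (t + suc n)            ≡⟨ periodic (t + suc n) ⟨
    x ((t + suc n) % suc n)  ≡⟨ cong x ([m+n]%n≡m%n t (suc n)) ⟩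
    x (t % suc n)            ≡⟨ periodic t ⟩
    x t                      ∎
    where open ≡-Reasoning

  orbit-window : ∀ k t → g ^ k * x (t + k) ≡ x t + m * window g k t
  orbit-window zero t = begin
    1 * x (t + 0)  ≡⟨ *-identityˡ (x (t + 0)) ⟩
    x (t + 0)      ≡⟨ cong x (+-identityʳ t) ⟩
    x t            ≡⟨ +-identityʳ (x t) ⟨
    x t + 0        ≡⟨ cong (x t +_) (*-zeroʳ m) ⟨
    x t + m * 0    ∎
    where open ≡-Reasoning
  orbit-window (suc k) t = begin
    g * g ^ k * x (t + suc k)        ≡⟨ cong (λ u → g * g ^ k * x u) (+-suc t k) ⟩
    g * g ^ k * x (suc t + k)        ≡⟨ *-assoc g (g ^ k) (x (suc t + k)) ⟩
    g * (g ^ k * x (suc t + k))      ≡⟨ cong (g *_) (orbit-window k (suc t)) ⟩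
    g * (x (suc t) + m * w)          ≡⟨ *-distribˡ-+ g (x (suc t)) (m * w) ⟩
    g * x (suc t) + g * (m * w)      ≡⟨ cong (_+ g * (m * w)) (step t) ⟩
    x t + m * b t + g * (m * w)      ≡⟨ rearrange (x t) m (b t) g w ⟩
    x t + m * (b t + g * w)          ∎
    where
    open ≡-Reasoning
    w : ℕ
    w = window g k (suc t)
    rearrange : ∀ a m c g w → a + m * c + g * (m * w) ≡ a + m * (c + g * w)
    rearrange = solve-∀

  orbit-shift : ∀ t → g ^ suc n * x t ≡ x t + m * window g (suc n) t
  orbit-shift t = trans (cong (g ^ suc n *_) (sym (x[t+1+n]≡x[t] t))) (orbit-window (suc n) t)

  -- g^(1+n) x₀ ≡ x₀ (mod m), and x₀ is a unit modulo m.
  m∣g^[1+n]∸1 : Coprime m (x 0) → m ∣ g ^ suc n ∸ 1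
  m∣g^[1+n]∸1 m⊥x₀ = coprime-divisor m⊥x₀ (divides (window g (suc n) 0) x₀[G∸1]≡)
    where
    open ≡-Reasoning
    G V : ℕ
    G = g ^ suc n
    V = window g (suc n) 0
    x₀[G∸1]≡ : x 0 * (G ∸ 1) ≡ V * m
    x₀[G∸1]≡ = begin
      x 0 * (G ∸ 1)        ≡⟨ *-distribˡ-∸ (x 0) G 1 ⟩
      x 0 * G ∸ x 0 * 1    ≡⟨ cong₂ _∸_ (*-comm (x 0) G) (*-identityʳ (x 0)) ⟩
      G * x 0 ∸ x 0        ≡⟨ cong (_∸ x 0) (orbit-shift 0) ⟩
      x 0 + m * V ∸ x 0    ≡⟨ m+n∸m≡n (x 0) (m * V) ⟩
      m * V                ≡⟨ *-comm m V ⟩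
      V * m                ∎

  1+n≤2^k : ∀ k → (∀ t → x t ≤ g ^ k) → suc n ≤ 2 ^ k
  1+n≤2^k k bounded = ≮⇒≥ no-collision
    where
    code : Fin (suc n) → Fin (2 ^ k)
    code i = fromℕ< (binary-window< k (toℕ i))
    -- Two start points with the same k digits give values congruent modulo g^k, inside [1, g^k].
    same-value : ∀ t s → window 2 k t ≡ window 2 k s → x t ≡ x s
    same-value t s codes≡ = residue-unique (positive t) (bounded t) (positive s) (bounded s)
      (trans (orbit-window k t) (cong (λ v → x t + m * v) (window-determined g k t s codes≡)))
      (orbit-window k s)
    no-collision : ¬ 2 ^ k < suc n
    no-collision 2^k<r with i , j , i<j , code≡ ← pigeonhole 2^k<r code =
      <⇒≢ i<j (trans (sym (toℕ%≡toℕ i)) (trans (injective _ _ (same-value _ _ window≡)) (toℕ%≡toℕ j)))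
      where
      window≡ : window 2 k (toℕ i) ≡ window 2 k (toℕ j)
      window≡ = trans (sym (toℕ-fromℕ< _)) (trans (cong toℕ code≡) (toℕ-fromℕ< _))

  orbit-quotient : ∀ {d} .{{_ : NonZero d}} → d ∣ m → Coprime d g → d ∣ x 0 → Orbit g (m / d) n
  orbit-quotient {d} d∣m d⊥g d∣x₀ = record
    { x = λ t → x t / d ; b = b ; b≤1 = b≤1 ; step = step/d
    ; periodic = λ t → cong (_/ d) (periodic t)
    ; injective = λ s t e → injective s t (/-cancelʳ-≡ (d∣x s) (d∣x t) e)
    ; positive = λ t → m≥n⇒m/n>0 (∣⇒≤ {{>-nonZero (positive t)}} (d∣x t)) }
    where
    d∣x : ∀ t → d ∣ x t
    d∣x zero    = d∣x₀
    d∣x (suc t) = coprime-divisor d⊥g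
      (subst (d ∣_) (sym (step t)) (∣m∣n⇒∣m+n (d∣x t) (∣-trans d∣m (m∣m*n (b t)))))
    step/d : ∀ t → g * (x (suc t) / d) ≡ x t / d + m / d * b t
    step/d t = begin
      g * (x (suc t) / d)        ≡⟨ *-/-assoc g (d∣x (suc t)) ⟨
      g * x (suc t) / d          ≡⟨ cong (_/ d) (step t) ⟩
      (x t + m * b t) / d        ≡⟨ +-distrib-/-∣ˡ (m * b t) (d∣x t) ⟩
      x t / d + m * b t / d      ≡⟨ cong (λ v → x t / d + v / d) (*-comm m (b t)) ⟩
      x t / d + b t * m / d      ≡⟨ cong (x t / d +_) (*-/-assoc (b t) d∣m) ⟩
      x t / d + b t * (m / d)    ≡⟨ cong (x t / d +_) (*-comm (b t) (m / d)) ⟩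
      x t / d + m / d * b t      ∎
      where open ≡-Reasoning

orbit-bounded : ∀ {q m n} → 1 ≤ q → (O : Orbit (suc q) m n) → ∀ t → q * Orbit.x O t ≤ m
orbit-bounded {q} {m} {n} 1≤q O t = Ga≡a+mc∧c<G⇒a≤m 1<G (window-bound q (suc n) t) shifted
  where
  open Orbit O
  open Window b b≤1
  G V : ℕ
  G = suc q ^ suc n
  V = window (suc q) (suc n) t
  1<G : 1 < G
  1<G = *-mono-≤ (s≤s 1≤q) (m^n>0 (suc q) n)
  shifted : G * (q * x t) ≡ q * x t + m * (q * V)
  shifted = begin
    G * (q * x t)        ≡⟨ *-comm G (q * x t) ⟩
    q * x t * G          ≡⟨ *-assoc q (x t) G ⟩
    q * (x t * G)        ≡⟨ cong (q *_) (trans (*-comm (x t) G) (orbit-shift O t)) ⟩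
    q * (x t + m * V)    ≡⟨ rearrange q (x t) m V ⟩
    q * x t + m * (q * V) ∎
    where
    open ≡-Reasoning
    rearrange : ∀ q a m V → q * (a + m * V) ≡ q * a + m * (q * V)
    rearrange = solve-∀

orbit⇒incomplete : ∀ {g m n} → Orbit g m n → Incomplete g m
orbit⇒incomplete {g} {m} {n} O = n , cycle , nontrivial
  where
  open Orbit O
  digit : ∀ {β} → β ≤ 1 → (ℤ.+ (m * β) ≡ ℤ.+ 0) ⊎ (ℤ.+ (m * β) ≡ ℤ.+ m)
  digit z≤n       = inj₁ (cong ℤ.+_ (*-zeroʳ m))
  digit (s≤s z≤n) = inj₂ (cong ℤ.+_ (*-identityʳ m))
  step-ℤ : ∀ j → ℤ.+ g ℤ.* ℤ.+ x (toℕ (next j)) ≡ ℤ.+ x (toℕ j) ℤ.+ ℤ.+ (m * b (toℕ j))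
  step-ℤ j = begin
    ℤ.+ g ℤ.* ℤ.+ x (toℕ (next j))      ≡⟨ ℤP.pos-* g _ ⟨
    ℤ.+ (g * x (toℕ (next j)))          ≡⟨ cong (λ i → ℤ.+ (g * x i)) (toℕ-mod (suc (toℕ j)) (suc n)) ⟩
    ℤ.+ (g * x (suc (toℕ j) % suc n))   ≡⟨ cong (λ y → ℤ.+ (g * y)) (periodic (suc (toℕ j))) ⟩
    ℤ.+ (g * x (suc (toℕ j)))           ≡⟨ cong ℤ.+_ (step (toℕ j)) ⟩
    ℤ.+ (x (toℕ j) + m * b (toℕ j))     ∎
    where open ≡-Reasoning
  cycle : ExtremeCycle g m n
  cycle = record
    { x = λ j → ℤ.+ x (toℕ j)
    ; l = λ j → ℤ.+ (m * b (toℕ j))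
    ; distinct = λ {i} {j} e → toℕ-injective (begin
        toℕ i          ≡⟨ toℕ%≡toℕ i ⟨
        toℕ i % suc n  ≡⟨ injective (toℕ i) (toℕ j) (ℤP.+-injective e) ⟩
        toℕ j % suc n  ≡⟨ toℕ%≡toℕ j ⟩
        toℕ j          ∎)
    ; digits = λ j → digit (b≤1 (toℕ j))
    ; step = step-ℤ }
    where open ≡-Reasoning
  nontrivial : ¬ IsTrivial cycle
  nontrivial (_ , all-zero) = <⇒≢ (positive 0) (sym (ℤP.+-injective (all-zero Fin.zero)))

digit⇒bit : ∀ {m l} → (l ≡ ℤ.+ 0) ⊎ (l ≡ ℤ.+ m) → Σ ℕ λ β → β ≤ 1 × l ≡ ℤ.+ (m * β)
digit⇒bit {m} (inj₁ l≡0) = 0 , z≤n , trans l≡0 (cong ℤ.+_ (sym (*-zeroʳ m)))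
digit⇒bit {m} (inj₂ l≡m) = 1 , s≤s z≤n , trans l≡m (cong ℤ.+_ (sym (*-identityʳ m)))

module _ {g m n : ℕ} (1<g : 1 < g) (2∣g : 2 ∣ g) (m-odd : ¬ 2 ∣ m)
         (c : ExtremeCycle g m n) (nontrivial : ¬ IsTrivial c) where
  open ExtremeCycle c

  private
    instance
      g≢0 : NonZero g
      g≢0 = >-nonZero (<-trans z<s 1<g)

    X : ℕ → ℤ
    X t = x (t mod suc n)

    bit-of : ∀ t → Σ ℕ λ β → β ≤ 1 × l (t mod suc n) ≡ ℤ.+ (m * β)
    bit-of t = digit⇒bit (digits (t mod suc n))

    bit : ℕ → ℕ
    bit t = proj₁ (bit-of t)

    bit≤1 : ∀ t → bit t ≤ 1
    bit≤1 t = proj₁ (proj₂ (bit-of t))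

    X-step : ∀ t → ℤ.+ g ℤ.* X (suc t) ≡ X t ℤ.+ ℤ.+ (m * bit t)
    X-step t = subst₂ (λ i l′ → ℤ.+ g ℤ.* x i ≡ X t ℤ.+ l′) (next-mod t)
                 (proj₂ (proj₂ (bit-of t))) (step (t mod suc n))

    X-nonneg : ∀ t → ℤ.+ 0 ℤ.≤ X t
    X-nonneg = periodic-growth⇒nonneg {n = n} X 1<g
      (λ t → subst (X t ℤ.≤_) (sym (X-step t)) (ℤP.i≤i+j (X t) (ℤ.+ (m * bit t))))
      (λ t → cong x (mod-cong (t + suc n) t (suc n) ([m+n]%n≡m%n t (suc n))))

    y : ℕ → ℕ
    y t = ℤ.∣ X t ∣

    X≡y : ∀ t → X t ≡ ℤ.+ y t
    X≡y t = sym (ℤP.0≤i⇒+∣i∣≡i (X-nonneg t))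

    y-step : ∀ t → g * y (suc t) ≡ y t + m * bit t
    y-step t = ℤP.+-injective (begin
      ℤ.+ (g * y (suc t))              ≡⟨ ℤP.pos-* g (y (suc t)) ⟩
      ℤ.+ g ℤ.* ℤ.+ y (suc t)          ≡⟨ cong (ℤ.+ g ℤ.*_) (X≡y (suc t)) ⟨
      ℤ.+ g ℤ.* X (suc t)              ≡⟨ X-step t ⟩
      X t ℤ.+ ℤ.+ (m * bit t)          ≡⟨ cong (ℤ._+ ℤ.+ (m * bit t)) (X≡y t) ⟩
      ℤ.+ (y t + m * bit t)            ∎)
      where open ≡-Reasoning

    y-injective : ∀ s t → y s ≡ y t → s % suc n ≡ t % suc n
    y-injective s t e = begin
      s % suc n               ≡⟨ toℕ-mod s (suc n) ⟨
      toℕ (s mod suc n)       ≡⟨ cong toℕ (distinct (trans (X≡y s) (trans (cong ℤ.+_ e) (sym (X≡y t))))) ⟩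
      toℕ (t mod suc n)       ≡⟨ toℕ-mod t (suc n) ⟩
      t % suc n               ∎
      where open ≡-Reasoning

    -- A zero value forces the digit 0 (g is even, m is odd), so the successor is zero too and
    -- injectivity collapses the cycle to {0}.
    y-positive : ∀ t → 1 ≤ y t
    y-positive t with y t in y≡0
    ... | suc _ = s≤s z≤n
    ... | zero  = ⊥-elim (nontrivial (n≡0 , all-zero))
      where
      y[1+t]≡0 : y (suc t) ≡ 0
      y[1+t]≡0 = even*y≡odd*bit⇒y≡0 2∣g m-odd (bit≤1 t) (trans (y-step t) (cong (_+ m * bit t) y≡0))
      n≡0 : n ≡ 0
      n≡0 = next-fixed⇒n≡0 (t mod suc n) (sym (distinct (begin
        x (t mod suc n)          ≡⟨ X≡y t ⟩
        ℤ.+ y t                  ≡⟨ cong ℤ.+_ (trans y≡0 (sym y[1+t]≡0)) ⟩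
        ℤ.+ y (suc t)            ≡⟨ X≡y (suc t) ⟨
        x (suc t mod suc n)      ≡⟨ cong x (next-mod t) ⟨
        x (next (t mod suc n))   ∎)))
        where open ≡-Reasoning
      all-zero : ∀ j → x j ≡ ℤ.+ 0
      all-zero j = trans (cong x (toℕ-injective (trans (toℕ≡0 j) (sym (toℕ≡0 (t mod suc n))))))
                         (trans (X≡y t) (cong ℤ.+_ y≡0))
        where
        toℕ≡0 : (i : Fin (suc n)) → toℕ i ≡ 0
        toℕ≡0 i = n<1⇒n≡0 (subst (toℕ i <_) (cong suc n≡0) (toℕ<n i))

  cycle⇒orbit : Orbit g m n
  cycle⇒orbit = record
    { x = y ; b = bit ; b≤1 = bit≤1 ; step = y-step
    ; periodic = λ t → cong (λ i → ℤ.∣ x i ∣) (mod-cong (t % suc n) t (suc n) (m%n%n≡m%n t (suc n)))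
    ; injective = y-injective ; positive = y-positive }

-- A common divisor d > 1 of m and x₀ divides the whole orbit, giving a cycle for the proper divisor m / d.
orbit-start-coprime : ∀ {g m n} .{{_ : NonZero m}} → Coprime m g →
                      (∀ d → d ∣ m → d ≢ m → Complete g d) → (O : Orbit g m n) → Coprime m (Orbit.x O 0)
orbit-start-coprime {m = m} m⊥g _ _ {0} (0∣m , _) = ⊥-elim (≢-nonZero⁻¹ m (0∣⇒≡0 0∣m))
orbit-start-coprime m⊥g _ _ {1} _ = refl
orbit-start-coprime {g} {m} m⊥g divisors-complete O {d@(suc (suc _))} (d∣m , d∣x₀) =
  ⊥-elim (divisors-complete (m / d) (m/n∣m d∣m) (<⇒≢ (m/n<m m d (s≤s (s≤s z≤n))))
           (orbit⇒incomplete (orbit-quotient O d∣m d⊥g d∣x₀)))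
  where
  d⊥g : Coprime d g
  d⊥g (e∣d , e∣g) = m⊥g (∣-trans e∣d d∣m , e∣g)

corollary2p32 : (g m : ℕ) → 4 ≤ g → 2 ∣ g → ¬ (2 ∣ m) → Coprime m g →
                  (o k : ℕ) → IsOrder g m o → IsCeilLog g m k →
                  2 ^ k < o → ¬ Primitive g m
corollary2p32 (suc q) m (s≤s 3≤q) 2∣g m-odd m⊥g o k (_ , _ , o-least) (m≤q*g^k , _) 2^k<o
              ((n , c , nontrivial) , divisors-complete) = <-irrefl refl (begin-strict
  2 ^ k  <⟨ 2^k<o ⟩
  o      ≤⟨ o-least (suc n) z<s (m∣g^[1+n]∸1 O (orbit-start-coprime m⊥g divisors-complete O)) ⟩
  suc n  ≤⟨ 1+n≤2^k O k bounded ⟩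
  2 ^ k  ∎)
  where
  open ≤-Reasoning
  1≤q : 1 ≤ q
  1≤q = ≤-trans (s≤s z≤n) 3≤q
  instance
    m≢0 : NonZero m
    m≢0 = ≢-nonZero (λ { refl → m-odd (2 ∣0) })
  O : Orbit (suc q) m n
  O = cycle⇒orbit (s≤s 1≤q) 2∣g m-odd c nontrivial
  bounded : ∀ t → Orbit.x O t ≤ suc q ^ k
  bounded t = *-cancelˡ-≤ q {{>-nonZero 1≤q}} (≤-trans (orbit-bounded 1≤q O t) m≤q*g^k)
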